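{- Let $t,u$ be $\lambda$-terms and $d\colon t\to_{\mathsf{shuf}}^* u$. Then there exist a vsub-term $s$ and a derivation $e\colon t\to_{\mathsf{vsub}}^* s$ such that: (1) $s\equiv \mathrm{mnf}(u)$; (2) $|d|_{\beta_v} = |e|_{\mathtt e}$ (number of $\beta_v$-steps of $d$ equals number of $\mathtt e$-steps of $e$); (3) if $u$ is $\mathsf{shuf}$-normal then $s$ and $\mathrm{mnf}(u)$ are $\mathsf{vsub}$-normal.
   Context: $\lambda$-terms: $t,u,s::= v\mid tu$, values $v::= x\mid \lambda x.t$, up to $\alpha$; $t\{x\leftarrow u\}$ capture-avoiding substitution. Shuffling calculus: balanced contexts $B::=\langle\cdot\rangle\mid tB\mid Bt\mid (\lambda x.B)t$. Root rules: $((\lambda x.t)u)s\mapsto_{\sigma_1}(\lambda x.ts)u$ if $x\notin\mathrm{fv}(s)$; $v((\lambda x.s)u)\mapsto_{\sigma_3}(\lambda x.vs)u$ if $v$ is a value and $x\notin\mathrm{fv}(v)$; $(\lambda x.t)v\mapsto_{\beta_v}t\{x\leftarrow v\}$ ($v$ a value). Their closures under balanced contexts give $\to_{\sigma_1},\to_{\sigma_3},\to_{\beta_v}$; $\to_{\sigma}=\to_{\sigma_1}\cup\to_{\sigma_3}$, $\to_{\mathsf{shuf}}=\to_{\beta_v}\cup\to_{\sigma}$. For a $\mathsf{shuf}$-derivation $d$, $|d|_{\beta_v}$ is its number of $\beta_v$-steps (well defined since a $\beta_v$-step and a $\sigma$-step from the same term never give the same result). Value substitution calculus: vsub-terms $t,u::=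 v\mid tu\mid t[x\leftarrow u]$, vsub-values $v::=x\mid\lambda x.t$; $t[x\leftarrow u]$ binds $x$ in $t$; every $\lambda$-term is a vsub-term. Evaluation contexts $E::=\langle\cdot\rangle\mid tE\mid Et\mid E[x\leftarrow u]\mid t[x\leftarrow E]$; substitution contexts $L::=\langle\cdot\rangle\mid L[x\leftarrow u]$. $\to_{\mathtt m}$ is the closure under evaluation contexts of $L\langle\lambda x.t\rangle u\mapsto L\langle t[x\leftarrow u]\rangle$, $\to_{\mathtt e}$ that of $t[x\leftarrow L\langle v\rangle]\mapsto L\langle t\{x\leftarrow v\}\rangle$ ($v$ vsub-value; variables bound by $L$ not free in $u$, resp. $t$); $\to_{\mathsf{vsub}}=\to_{\mathtt m}\cup\to_{\mathtt e}$. $\to_{\mathtt m}$ is terminating and confluent, so each vsub-term $t$ has a unique $\mathtt m$-normal form $\mathrm{mnf}(t)$. Structural equivalence $\equiv$: least equivalence on vsub-terms closed under evaluation contexts containing $t[y\leftarrow s][x\leftarrow u]\equiv t[x\leftarrow u][y\leftarrow s]$ ($y\notin\mathrm{fv}(u)$, $x\notin\mathrm{fv}(s)$); $t\,(s[x\leftarrow u])\equiv (ts)[x\leftarrow u]$ ($x\notin\mathrm{fv}(t)$); $t[x\leftarrow u]\,s\equiv (ts)[x\leftarrow u]$ ($x\notin\mathrm{fv}(s)$); $t[x\leftarrow u[y\leftarrow s]]\equiv t[x\leftarrow u][y\leftarrow s]$ ($y\notin\mathrm{fv}(t)$). -}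

module Defs where

open import Data.Nat using (ℕ; zero; suc; _+_)
open import Data.Fin using (Fin; zero; suc)
open import Data.Product using (Σ; _×_; _,_)
open import Relation.Nullary using (¬_)

-- Scoped de Bruijn syntax: terms are taken up to α-equivalence.
-- A term of type Tm n has its free variables among Fin n.

data Tm (n : ℕ) : Set where
  var : Fin n → Tm n
  lam : Tm (suc n) → Tm n
  app : Tm n → Tm n → Tm n

data IsValue {n : ℕ} : Tm n → Set where
  var-val : (x : Fin n) → IsValue (var x)
  lam-val : (t : Tm (suc n)) → IsValue (lam t)

Ren : ℕ → ℕ → Set
Ren n m = Fin n → Fin m

extR : ∀ {n m} → Ren n m → Ren (suc n) (suc m)
extR ρ zero    = zero
extR ρ (suc i) = suc (ρ i)

ren : ∀ {n m} → Ren n m → Tm n → Tm m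
ren ρ (var x)   = var (ρ x)
ren ρ (lam t)   = lam (ren (extR ρ) t)
ren ρ (app t u) = app (ren ρ t) (ren ρ u)

wk : ∀ {n} → Tm n → Tm (suc n)
wk = ren suc

Sub : ℕ → ℕ → Set
Sub n m = Fin n → Tm m

extS : ∀ {n m} → Sub n m → Sub (suc n) (suc m)
extS σ zero    = var zero
extS σ (suc i) = wk (σ i)

sub : ∀ {n m} → Sub n m → Tm n → Tm m
sub σ (var x)   = σ x
sub σ (lam t)   = lam (sub (extS σ) t)
sub σ (app t u) = app (sub σ t) (sub σ u)

sub0 : ∀ {n} → Tm n → Sub (suc n) n
sub0 v zero    = v
sub0 v (suc i) = var i

_[_]₀ : ∀ {n} → Tm (suc n) → Tm n → Tm n
t [ v ]₀ = sub (sub0 v) t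

-- Shuffling calculus (closure under balanced contexts
--   B ::= ⟨·⟩ | t B | B t | (λx.B) t ).
-- Steps are labelled by the rule used at the root.

data ShufRule : Set where
  βv σ₁ σ₃ : ShufRule

data _⟶shuf[_]_ {n : ℕ} : Tm n → ShufRule → Tm n → Set where
  -- ((λx.t)u)s ↦ (λx.ts)u,  x ∉ fv(s)  (s weakened under the binder)
  root-σ₁ : (t : Tm (suc n)) (u s : Tm n) →
            app (app (lam t) u) s ⟶shuf[ σ₁ ] app (lam (app t (wk s))) u
  -- v((λx.s)u) ↦ (λx.vs)u,  v value, x ∉ fv(v)
  root-σ₃ : (v : Tm n) → IsValue v → (s : Tm (suc n)) (u : Tm n) →
            app v (app (lam s) u) ⟶shuf[ σ₃ ] app (lam (app (wk v) s)) u
  root-βv : (t : Tm (suc n)) (v : Tm n) → IsValue v →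
            app (lam t) v ⟶shuf[ βv ] (t [ v ]₀)
  appR : ∀ {r u u'} (t : Tm n) → u ⟶shuf[ r ] u' → app t u ⟶shuf[ r ] app t u'
  appL : ∀ {r t t'} (u : Tm n) → t ⟶shuf[ r ] t' → app t u ⟶shuf[ r ] app t' u
  lamApp : ∀ {r} {t t' : Tm (suc n)} (u : Tm n) →
           t ⟶shuf[ r ] t' → app (lam t) u ⟶shuf[ r ] app (lam t') u

_⟶shuf_ : ∀ {n} → Tm n → Tm n → Set
t ⟶shuf u = Σ ShufRule (λ r → t ⟶shuf[ r ] u)

data ShufDeriv {n : ℕ} : Tm n → Tm n → Set where
  [] : ∀ {t} → ShufDeriv t t
  _∷_ : ∀ {r t t' u} → t ⟶shuf[ r ] t' → ShufDeriv t' u → ShufDeriv t u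

βv-count : ∀ {n} {t u : Tm n} → ShufDeriv t u → ℕ
βv-count [] = 0
βv-count (_∷_ {r = βv} _ d) = suc (βv-count d)
βv-count (_∷_ {r = σ₁} _ d) = βv-count d
βv-count (_∷_ {r = σ₃} _ d) = βv-count d

shuf-normal : ∀ {n} → Tm n → Set
shuf-normal t = ∀ u → ¬ (t ⟶shuf u)

-- Value substitution calculus.  es t u  stands for  t[x←u]
-- where x is the variable 0 of t.

data VTm (n : ℕ) : Set where
  var : Fin n → VTm n
  lam : VTm (suc n) → VTm n
  app : VTm n → VTm n → VTm n
  es  : VTm (suc n) → VTm n → VTm n

data IsVValue {n : ℕ} : VTm n → Set where
  var-val : (x : Fin n) → IsVValue (var x)
  lam-val : (t : VTm (suc n)) → IsVValue (lam t)

vren : ∀ {n m} → Ren n m → VTm n → VTm m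
vren ρ (var x)   = var (ρ x)
vren ρ (lam t)   = lam (vren (extR ρ) t)
vren ρ (app t u) = app (vren ρ t) (vren ρ u)
vren ρ (es t u)  = es (vren (extR ρ) t) (vren ρ u)

vwk : ∀ {n} → VTm n → VTm (suc n)
vwk = vren suc

VSub : ℕ → ℕ → Set
VSub n m = Fin n → VTm m

vextS : ∀ {n m} → VSub n m → VSub (suc n) (suc m)
vextS σ zero    = var zero
vextS σ (suc i) = vwk (σ i)

vsub : ∀ {n m} → VSub n m → VTm n → VTm m
vsub σ (var x)   = σ x
vsub σ (lam t)   = lam (vsub (vextS σ) t)
vsub σ (app t u) = app (vsub σ t) (vsub σ u)
vsub σ (es t u)  = es (vsub (vextS σ) t) (vsub σ u)

⌜_⌝ : ∀ {n} → Tm n → VTm n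
⌜ var x ⌝   = var x
⌜ lam t ⌝   = lam ⌜ t ⌝
⌜ app t u ⌝ = app ⌜ t ⌝ ⌜ u ⌝

-- substitution contexts  L ::= ⟨·⟩ | L[x←u] ;
-- SCtx n m : the whole term lives in scope n, the hole in scope m.
data SCtx : ℕ → ℕ → Set where
  hole : ∀ {n} → SCtx n n
  _[←_] : ∀ {n m} → SCtx (suc n) m → VTm n → SCtx n m

plugL : ∀ {n m} → SCtx n m → VTm m → VTm n
plugL hole t = t
plugL (L [← u ]) t = es (plugL L t) u

-- renaming of the outer scope into the hole scope (skipping the
-- variables bound by L)
skipL : ∀ {n m} → SCtx n m → Ren n m
skipL hole i = i
skipL (L [← u ]) i = skipL L (suc i)

-- t{x←v} for t in scope (suc n) put under L : SCtx n m, v in scope m;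
-- the variables bound by L are not free in t
substUnder : ∀ {n m} → SCtx n m → VTm (suc n) → VTm m → VTm m
substUnder L t v = vsub σ t
  where
    σ : VSub _ _
    σ zero    = v
    σ (suc i) = var (skipL L i)

data VRule : Set where
  𝕞 𝕖 : VRule

-- closure under evaluation contexts
--   E ::= ⟨·⟩ | t E | E t | E[x←u] | t[x←E]
data _⟶vsub[_]_ {n : ℕ} : VTm n → VRule → VTm n → Set where
  -- L⟨λx.t⟩ u ↦ L⟨t[x←u]⟩   (vars bound by L not free in u)
  root-m : ∀ {m} (L : SCtx n m) (t : VTm (suc m)) (u : VTm n) →
           app (plugL L (lam t)) u ⟶vsub[ 𝕞 ]
             plugL L (es t (vren (skipL L) u))
  -- t[x←L⟨v⟩] ↦ L⟨t{x←v}⟩   (v value, vars bound by L not free in t)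
  root-e : ∀ {m} (t : VTm (suc n)) (L : SCtx n m) (v : VTm m) → IsVValue v →
           es t (plugL L v) ⟶vsub[ 𝕖 ] plugL L (substUnder L t v)
  appR : ∀ {r u u'} (t : VTm n) → u ⟶vsub[ r ] u' → app t u ⟶vsub[ r ] app t u'
  appL : ∀ {r t t'} (u : VTm n) → t ⟶vsub[ r ] t' → app t u ⟶vsub[ r ] app t' u
  esL  : ∀ {r} {t t' : VTm (suc n)} (u : VTm n) →
         t ⟶vsub[ r ] t' → es t u ⟶vsub[ r ] es t' u
  esR  : ∀ {r u u'} (t : VTm (suc n)) → u ⟶vsub[ r ] u' → es t u ⟶vsub[ r ] es t u'

_⟶vsub_ : ∀ {n} → VTm n → VTm n → Set
t ⟶vsub u = Σ VRule (λ r → t ⟶vsub[ r ] u)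

_⟶m_ : ∀ {n} → VTm n → VTm n → Set
t ⟶m u = t ⟶vsub[ 𝕞 ] u

data VsubDeriv {n : ℕ} : VTm n → VTm n → Set where
  [] : ∀ {t} → VsubDeriv t t
  _∷_ : ∀ {r t t' u} → t ⟶vsub[ r ] t' → VsubDeriv t' u → VsubDeriv t u

e-count : ∀ {n} {t u : VTm n} → VsubDeriv t u → ℕ
e-count [] = 0
e-count (_∷_ {r = 𝕖} _ d) = suc (e-count d)
e-count (_∷_ {r = 𝕞} _ d) = e-count d

data _⟶m*_ {n : ℕ} : VTm n → VTm n → Set where
  [] : ∀ {t} → t ⟶m* t
  _∷_ : ∀ {t t' u} → t ⟶m t' → t' ⟶m* u → t ⟶m* u

m-normal : ∀ {n} → VTm n → Set
m-normal t = ∀ u → ¬ (t ⟶m u)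

vsub-normal : ∀ {n} → VTm n → Set
vsub-normal t = ∀ u → ¬ (t ⟶vsub u)

-- s is the m-normal form of t (unique, since →m is confluent and terminating)
IsMnf : ∀ {n} → VTm n → VTm n → Set
IsMnf t s = (t ⟶m* s) × m-normal s

swap01 : ∀ {n} → Ren (suc (suc n)) (suc (suc n))
swap01 zero          = suc zero
swap01 (suc zero)    = zero
swap01 (suc (suc i)) = suc (suc i)

data _≡str_ {n : ℕ} : VTm n → VTm n → Set where
  -- t[y←s][x←u] ≡ t[x←u][y←s]   (y ∉ fv u, x ∉ fv s)
  ax-com : (t : VTm (suc (suc n))) (s u : VTm n) →
           es (es t (vwk s)) u ≡str es (es (vren swap01 t) (vwk u)) s
  -- t (s[x←u]) ≡ (t s)[x←u]   (x ∉ fv t)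
  ax-appr  : (t : VTm n) (s : VTm (suc n)) (u : VTm n) →
           app t (es s u) ≡str es (app (vwk t) s) u
  -- t[x←u] s ≡ (t s)[x←u]   (x ∉ fv s)
  ax-appl  : (t : VTm (suc n)) (u s : VTm n) →
           app (es t u) s ≡str es (app t (vwk s)) u
  -- t[x←u[y←s]] ≡ t[x←u][y←s]   (y ∉ fv t)
  ax-[·] : (t : VTm (suc n)) (u : VTm (suc n)) (s : VTm n) →
           es t (es u s) ≡str es (es (vren (extR suc) t) u) s
  ≡refl  : ∀ {t} → t ≡str t
  ≡sym   : ∀ {t u} → t ≡str u → u ≡str t
  ≡trans : ∀ {t u s} → t ≡str u → u ≡str s → t ≡str s
  appR : ∀ {u u'} (t : VTm n) → u ≡str u' → app t u ≡str app t u'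
  appL : ∀ {t t'} (u : VTm n) → t ≡str t' → app t u ≡str app t' u
  esL  : ∀ {t t' : VTm (suc n)} (u : VTm n) → t ≡str t' → es t u ≡str es t' u
  esR  : ∀ {u u'} (t : VTm (suc n)) → u ≡str u' → es t u ≡str es t u'

-- A shuffling derivation is simulated by a vsub-derivation up to structural
-- equivalence. A λ-term u is related to the vsub-terms obtained from ⌜ u ⌝ by
-- turning some redexes (λx.a)b outside abstractions into a[x←b];
-- then each shuffling step of u is matched by m-steps, plus one e-step exactly
-- when it is a βv-step, up to an axiom of ≡str.
-- Since ≡str is a strong bisimulation for →vsub that preserves the kind of each
-- step, the equivalences can be pushed to the end of the derivation. Finally,
-- m-steps decrease the number of applications, so m-normal forms exist; when u
-- is shuffling normal, turning all its redexes outside abstractions into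
-- explicit substitutions already yields a vsub-normal term, hence mnf(u).

module Submission where

open import Defs
open import Data.Nat using (ℕ; suc; _+_; _<_; s≤s)
open import Data.Nat.Properties using (+-identityʳ; n<1+n; +-monoʳ-<; +-monoˡ-<; +-commutativeSemigroup)
open import Data.Nat.Induction using (<-wellFounded)
open import Algebra.Properties.CommutativeSemigroup +-commutativeSemigroup using (xy∙z≈xz∙y)
open import Induction.WellFounded using (Acc; acc)
open import Data.Fin using (Fin; zero; suc)
open import Data.Product using (Σ; _×_; _,_; proj₁; proj₂)
open import Data.Sum using (_⊎_; inj₁; inj₂)
open import Data.Empty using (⊥-elim)
open import Relation.Nullary using (¬_; Dec; yes; no)
open import Relation.Binary.PropositionalEquality
open import Function using (_∘_; id)

extR-cong : ∀ {n m} {ρ ρ' : Ren n m} → ρ ≗ ρ' → extR ρ ≗ extR ρ'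
extR-cong e zero    = refl
extR-cong e (suc i) = cong suc (e i)

extR-∘ : ∀ {n m k} (ρ : Ren m k) (ρ' : Ren n m) → extR ρ ∘ extR ρ' ≗ extR (ρ ∘ ρ')
extR-∘ ρ ρ' zero    = refl
extR-∘ ρ ρ' (suc i) = refl

extR-id : ∀ {n} → extR id ≗ id {A = Fin (suc n)}
extR-id zero    = refl
extR-id (suc i) = refl

vren-cong : ∀ {n m} {ρ ρ' : Ren n m} → ρ ≗ ρ' → ∀ t → vren ρ t ≡ vren ρ' t
vren-cong e (var x)   = cong var (e x)
vren-cong e (lam t)   = cong lam (vren-cong (extR-cong e) t)
vren-cong e (app t u) = cong₂ app (vren-cong e t) (vren-cong e u)
vren-cong e (es t u)  = cong₂ es (vren-cong (extR-cong e) t) (vren-cong e u)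

vren-∘ : ∀ {n m k} (ρ : Ren m k) (ρ' : Ren n m) t → vren ρ (vren ρ' t) ≡ vren (ρ ∘ ρ') t
vren-∘ ρ ρ' (var x)   = refl
vren-∘ ρ ρ' (lam t)   = cong lam (trans (vren-∘ (extR ρ) (extR ρ') t) (vren-cong (extR-∘ ρ ρ') t))
vren-∘ ρ ρ' (app t u) = cong₂ app (vren-∘ ρ ρ' t) (vren-∘ ρ ρ' u)
vren-∘ ρ ρ' (es t u)  =
  cong₂ es (trans (vren-∘ (extR ρ) (extR ρ') t) (vren-cong (extR-∘ ρ ρ') t)) (vren-∘ ρ ρ' u)

vren-id : ∀ {n} (t : VTm n) → vren id t ≡ t
vren-id (var x)   = refl
vren-id (lam t)   = cong lam (trans (vren-cong extR-id t) (vren-id t))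
vren-id (app t u) = cong₂ app (vren-id t) (vren-id u)
vren-id (es t u)  = cong₂ es (trans (vren-cong extR-id t) (vren-id t)) (vren-id u)

vren-vren : ∀ {n m k} {ρ : Ren m k} {ρ' : Ren n m} {ρ'' : Ren n k} →
            ρ ∘ ρ' ≗ ρ'' → ∀ t → vren ρ (vren ρ' t) ≡ vren ρ'' t
vren-vren {ρ = ρ} {ρ'} e t = trans (vren-∘ ρ ρ' t) (vren-cong e t)

vren-commute : ∀ {n m m' k} {ρ₁ : Ren m k} {ρ₂ : Ren n m} {ρ₃ : Ren m' k} {ρ₄ : Ren n m'} →
               ρ₁ ∘ ρ₂ ≗ ρ₃ ∘ ρ₄ → ∀ t → vren ρ₁ (vren ρ₂ t) ≡ vren ρ₃ (vren ρ₄ t)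
vren-commute {ρ₁ = ρ₁} {ρ₂} {ρ₃} {ρ₄} e t =
  trans (vren-∘ ρ₁ ρ₂ t) (trans (vren-cong e t) (sym (vren-∘ ρ₃ ρ₄ t)))

vren-extR-vwk : ∀ {n m} (ρ : Ren n m) t → vren (extR ρ) (vwk t) ≡ vwk (vren ρ t)
vren-extR-vwk ρ = vren-commute λ _ → refl

vextS-cong : ∀ {n m} {σ σ' : VSub n m} → σ ≗ σ' → vextS σ ≗ vextS σ'
vextS-cong e zero    = refl
vextS-cong e (suc i) = cong vwk (e i)

vsub-cong : ∀ {n m} {σ σ' : VSub n m} → σ ≗ σ' → ∀ t → vsub σ t ≡ vsub σ' t
vsub-cong e (var x)   = e x
vsub-cong e (lam t)   = cong lam (vsub-cong (vextS-cong e) t)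
vsub-cong e (app t u) = cong₂ app (vsub-cong e t) (vsub-cong e u)
vsub-cong e (es t u)  = cong₂ es (vsub-cong (vextS-cong e) t) (vsub-cong e u)

vextS-extR : ∀ {n m k} (σ : VSub m k) (ρ : Ren n m) → vextS σ ∘ extR ρ ≗ vextS (σ ∘ ρ)
vextS-extR σ ρ zero    = refl
vextS-extR σ ρ (suc i) = refl

vsub-vren : ∀ {n m k} (σ : VSub m k) (ρ : Ren n m) t → vsub σ (vren ρ t) ≡ vsub (σ ∘ ρ) t
vsub-vren σ ρ (var x)   = refl
vsub-vren σ ρ (lam t)   = cong lam (trans (vsub-vren (vextS σ) (extR ρ) t) (vsub-cong (vextS-extR σ ρ) t))
vsub-vren σ ρ (app t u) = cong₂ app (vsub-vren σ ρ t) (vsub-vren σ ρ u)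
vsub-vren σ ρ (es t u)  =
  cong₂ es (trans (vsub-vren (vextS σ) (extR ρ) t) (vsub-cong (vextS-extR σ ρ) t)) (vsub-vren σ ρ u)

extR-vextS : ∀ {n m k} (ρ : Ren m k) (σ : VSub n m) → vren (extR ρ) ∘ vextS σ ≗ vextS (vren ρ ∘ σ)
extR-vextS ρ σ zero    = refl
extR-vextS ρ σ (suc i) = vren-extR-vwk ρ (σ i)

vren-vsub : ∀ {n m k} (ρ : Ren m k) (σ : VSub n m) t → vren ρ (vsub σ t) ≡ vsub (vren ρ ∘ σ) t
vren-vsub ρ σ (var x)   = refl
vren-vsub ρ σ (lam t)   = cong lam (trans (vren-vsub (extR ρ) (vextS σ) t) (vsub-cong (extR-vextS ρ σ) t))
vren-vsub ρ σ (app t u) = cong₂ app (vren-vsub ρ σ t) (vren-vsub ρ σ u)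
vren-vsub ρ σ (es t u)  =
  cong₂ es (trans (vren-vsub (extR ρ) (vextS σ) t) (vsub-cong (extR-vextS ρ σ) t)) (vren-vsub ρ σ u)

vextS-var : ∀ {n} → vextS var ≗ var {n = suc n}
vextS-var zero    = refl
vextS-var (suc i) = refl

vsub-var : ∀ {n} (t : VTm n) → vsub var t ≡ t
vsub-var (var x)   = refl
vsub-var (lam t)   = cong lam (trans (vsub-cong vextS-var t) (vsub-var t))
vsub-var (app t u) = cong₂ app (vsub-var t) (vsub-var u)
vsub-var (es t u)  = cong₂ es (trans (vsub-cong vextS-var t) (vsub-var t)) (vsub-var u)

vren≗vsub : ∀ {n m} (ρ : Ren n m) t → vren ρ t ≡ vsub (var ∘ ρ) t
vren≗vsub ρ t = trans (sym (vsub-var (vren ρ t))) (vsub-vren var ρ t)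

vsub-vren-commute : ∀ {n m m' k} {σ' : VSub m k} {ρ : Ren n m} {ρ' : Ren m' k} {σ : VSub n m'} →
                    σ' ∘ ρ ≗ vren ρ' ∘ σ → ∀ t → vsub σ' (vren ρ t) ≡ vren ρ' (vsub σ t)
vsub-vren-commute {σ' = σ'} {ρ} {ρ'} {σ} e t =
  trans (vsub-vren σ' ρ t) (trans (vsub-cong e t) (sym (vren-vsub ρ' σ t)))

vsub-vwk : ∀ {n m} (σ : VSub n m) t → vsub (vextS σ) (vwk t) ≡ vwk (vsub σ t)
vsub-vwk σ = vsub-vren-commute λ _ → refl

vsub0 : ∀ {n} → VTm n → VSub (suc n) n
vsub0 v zero    = v
vsub0 v (suc i) = var i

vsub0-vwk : ∀ {n} (v : VTm n) t → vsub (vsub0 v) (vwk t) ≡ t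
vsub0-vwk v t = trans (vsub-vren (vsub0 v) suc t) (vsub-var t)

⌜ren⌝ : ∀ {n m} (ρ : Ren n m) t → ⌜ ren ρ t ⌝ ≡ vren ρ ⌜ t ⌝
⌜ren⌝ ρ (var x)   = refl
⌜ren⌝ ρ (lam t)   = cong lam (⌜ren⌝ (extR ρ) t)
⌜ren⌝ ρ (app t u) = cong₂ app (⌜ren⌝ ρ t) (⌜ren⌝ ρ u)

⌜extS⌝ : ∀ {n m} (σ : Sub n m) → ⌜_⌝ ∘ extS σ ≗ vextS (⌜_⌝ ∘ σ)
⌜extS⌝ σ zero    = refl
⌜extS⌝ σ (suc i) = ⌜ren⌝ suc (σ i)

⌜sub⌝ : ∀ {n m} (σ : Sub n m) t → ⌜ sub σ t ⌝ ≡ vsub (⌜_⌝ ∘ σ) ⌜ t ⌝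
⌜sub⌝ σ (var x)   = refl
⌜sub⌝ σ (lam t)   = cong lam (trans (⌜sub⌝ (extS σ) t) (vsub-cong (⌜extS⌝ σ) ⌜ t ⌝))
⌜sub⌝ σ (app t u) = cong₂ app (⌜sub⌝ σ t) (⌜sub⌝ σ u)

-- LAbs a and LVal a say that a is L⟨λx.t⟩, resp. L⟨v⟩. Stating the root rules
-- through them instead of plugL makes steps amenable to pattern matching;
-- _⟶[_]_ is _⟶vsub[_]_ in this form.
data LAbs {n : ℕ} : VTm n → Set where
  abs    : ∀ t → LAbs (lam t)
  abs-es : ∀ {t} u → LAbs t → LAbs (es t u)

data LVal {n : ℕ} : VTm n → Set where
  val    : ∀ {v} → IsVValue v → LVal v
  val-es : ∀ {t} u → LVal t → LVal (es t u)

m-reduct : ∀ {n} {a : VTm n} → LAbs a → VTm n → VTm n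
m-reduct (abs t)      u = es t u
m-reduct (abs-es w p) u = es (m-reduct p (vwk u)) w

e-reduct : ∀ {n} (t : VTm (suc n)) {a : VTm n} → LVal a → VTm n
e-reduct t {v} (val _)  = vsub (vsub0 v) t
e-reduct t (val-es w p) = es (e-reduct (vren (extR suc) t) p) w

m-reduct-irr : ∀ {n} {a : VTm n} (p q : LAbs a) u → m-reduct p u ≡ m-reduct q u
m-reduct-irr (abs t)      (abs .t)      u = refl
m-reduct-irr (abs-es w p) (abs-es .w q) u = cong (λ z → es z w) (m-reduct-irr p q (vwk u))

e-reduct-irr : ∀ {n} t {a : VTm n} (p q : LVal a) → e-reduct t p ≡ e-reduct t q
e-reduct-irr t (val _)      (val _)       = refl
e-reduct-irr t (val-es w p) (val-es .w q) = cong (λ z → es z w) (e-reduct-irr _ p q)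

infix 4 _⟶[_]_
data _⟶[_]_ {n : ℕ} : VTm n → VRule → VTm n → Set where
  m-root : ∀ {a} (p : LAbs a) u → app a u ⟶[ 𝕞 ] m-reduct p u
  e-root : ∀ t {a} (p : LVal a) → es t a ⟶[ 𝕖 ] e-reduct t p
  appR   : ∀ {r u u'} (t : VTm n) → u ⟶[ r ] u' → app t u ⟶[ r ] app t u'
  appL   : ∀ {r t t'} (u : VTm n) → t ⟶[ r ] t' → app t u ⟶[ r ] app t' u
  esL    : ∀ {r} {t t' : VTm (suc n)} (u : VTm n) → t ⟶[ r ] t' → es t u ⟶[ r ] es t' u
  esR    : ∀ {r u u'} (t : VTm (suc n)) → u ⟶[ r ] u' → es t u ⟶[ r ] es t u'

LAbs-plugL : ∀ {n m} (L : SCtx n m) t → LAbs (plugL L (lam t))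
LAbs-plugL hole       t = abs t
LAbs-plugL (L [← u ]) t = abs-es u (LAbs-plugL L t)

m-reduct-plugL : ∀ {n m} (L : SCtx n m) t u →
                 m-reduct (LAbs-plugL L t) u ≡ plugL L (es t (vren (skipL L) u))
m-reduct-plugL hole       t u = cong (es t) (sym (vren-id u))
m-reduct-plugL (L [← w ]) t u = cong (λ z → es z w)
  (trans (m-reduct-plugL L t (vwk u)) (cong (λ z → plugL L (es t z)) (vren-∘ (skipL L) suc u)))

LVal-plugL : ∀ {n m} (L : SCtx n m) {v} → IsVValue v → LVal (plugL L v)
LVal-plugL hole       pv = val pv
LVal-plugL (L [← u ]) pv = val-es u (LVal-plugL L pv)

substUnder-hole : ∀ {n} (t : VTm (suc n)) v → vsub (vsub0 v) t ≡ substUnder hole t v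
substUnder-hole t v = vsub-cong (λ { zero → refl ; (suc i) → refl }) t

substUnder-[←] : ∀ {n m} (L : SCtx (suc n) m) w t v →
                 substUnder L (vren (extR suc) t) v ≡ substUnder (L [← w ]) t v
substUnder-[←] L w t v = trans (vsub-vren _ (extR suc) t) (vsub-cong (λ { zero → refl ; (suc i) → refl }) t)

e-reduct-plugL : ∀ {n m} (L : SCtx n m) t {v} (pv : IsVValue v) →
                 e-reduct t (LVal-plugL L pv) ≡ plugL L (substUnder L t v)
e-reduct-plugL hole       t {v} pv = substUnder-hole t v
e-reduct-plugL (L [← w ]) t {v} pv = cong (λ z → es z w)
  (trans (e-reduct-plugL L (vren (extR suc) t) pv) (cong (plugL L) (substUnder-[←] L w t v)))

⟶vsub⇒⟶ : ∀ {n r} {a b : VTm n} → a ⟶vsub[ r ] b → a ⟶[ r ] b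
⟶vsub⇒⟶ (root-m L t u) =
  subst (app (plugL L (lam t)) u ⟶[ 𝕞 ]_) (m-reduct-plugL L t u) (m-root (LAbs-plugL L t) u)
⟶vsub⇒⟶ (root-e t L v pv) =
  subst (es t (plugL L v) ⟶[ 𝕖 ]_) (e-reduct-plugL L t pv) (e-root t (LVal-plugL L pv))
⟶vsub⇒⟶ (appR t s) = appR t (⟶vsub⇒⟶ s)
⟶vsub⇒⟶ (appL u s) = appL u (⟶vsub⇒⟶ s)
⟶vsub⇒⟶ (esL u s)  = esL u (⟶vsub⇒⟶ s)
⟶vsub⇒⟶ (esR t s)  = esR t (⟶vsub⇒⟶ s)

record AbsUnder {n : ℕ} (a : VTm n) : Set where
  constructor abs-under
  field
    {m}  : ℕ
    L    : SCtx n m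
    body : VTm (suc m)
    eq   : a ≡ plugL L (lam body)

record ValUnder {n : ℕ} (a : VTm n) : Set where
  constructor val-under
  field
    {m}     : ℕ
    L       : SCtx n m
    v       : VTm m
    isValue : IsVValue v
    eq      : a ≡ plugL L v

LAbs⇒AbsUnder : ∀ {n} {a : VTm n} → LAbs a → AbsUnder a
LAbs⇒AbsUnder (abs t) = abs-under hole t refl
LAbs⇒AbsUnder (abs-es u p) with LAbs⇒AbsUnder p
... | abs-under L t refl = abs-under (L [← u ]) t refl

LVal⇒ValUnder : ∀ {n} {a : VTm n} → LVal a → ValUnder a
LVal⇒ValUnder (val pv) = val-under hole _ pv refl
LVal⇒ValUnder (val-es u p) with LVal⇒ValUnder p
... | val-under L v pv refl = val-under (L [← u ]) v pv refl

⟶⇒⟶vsub : ∀ {n r} {a b : VTm n} → a ⟶[ r ] b → a ⟶vsub[ r ] b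
⟶⇒⟶vsub (m-root p u) with LAbs⇒AbsUnder p
... | abs-under L t refl = subst (app (plugL L (lam t)) u ⟶vsub[ 𝕞 ]_)
        (trans (sym (m-reduct-plugL L t u)) (m-reduct-irr (LAbs-plugL L t) p u)) (root-m L t u)
⟶⇒⟶vsub (e-root t p) with LVal⇒ValUnder p
... | val-under L v pv refl = subst (es t (plugL L v) ⟶vsub[ 𝕖 ]_)
        (trans (sym (e-reduct-plugL L t pv)) (e-reduct-irr t (LVal-plugL L pv) p)) (root-e t L v pv)
⟶⇒⟶vsub (appR t s) = appR t (⟶⇒⟶vsub s)
⟶⇒⟶vsub (appL u s) = appL u (⟶⇒⟶vsub s)
⟶⇒⟶vsub (esL u s)  = esL u (⟶⇒⟶vsub s)
⟶⇒⟶vsub (esR t s)  = esR t (⟶⇒⟶vsub s)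

IsVValue-vren : ∀ {n m} (ρ : Ren n m) {v} → IsVValue v → IsVValue (vren ρ v)
IsVValue-vren ρ (var-val x) = var-val (ρ x)
IsVValue-vren ρ (lam-val t) = lam-val _

LAbs-vren : ∀ {n m} (ρ : Ren n m) {a} → LAbs a → LAbs (vren ρ a)
LAbs-vren ρ (abs t)      = abs _
LAbs-vren ρ (abs-es u p) = abs-es _ (LAbs-vren (extR ρ) p)

LVal-vren : ∀ {n m} (ρ : Ren n m) {a} → LVal a → LVal (vren ρ a)
LVal-vren ρ (val pv)     = val (IsVValue-vren ρ pv)
LVal-vren ρ (val-es u p) = val-es _ (LVal-vren (extR ρ) p)

LAbs-unvren : ∀ {n m} (ρ : Ren n m) a → LAbs (vren ρ a) → LAbs a
LAbs-unvren ρ (lam t)  p            = abs t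
LAbs-unvren ρ (es a u) (abs-es _ p) = abs-es u (LAbs-unvren (extR ρ) a p)

LVal-unvren : ∀ {n m} (ρ : Ren n m) a → LVal (vren ρ a) → LVal a
LVal-unvren ρ (var x)   p            = val (var-val x)
LVal-unvren ρ (lam t)   p            = val (lam-val t)
LVal-unvren ρ (app a u) (val ())
LVal-unvren ρ (es a u)  (val-es _ p) = val-es u (LVal-unvren (extR ρ) a p)

m-reduct-vren : ∀ {n m} (ρ : Ren n m) {a} (p : LAbs a) u →
                vren ρ (m-reduct p u) ≡ m-reduct (LAbs-vren ρ p) (vren ρ u)
m-reduct-vren ρ (abs t)      u = refl
m-reduct-vren ρ (abs-es w p) u = cong (λ z → es z (vren ρ w))
  (trans (m-reduct-vren (extR ρ) p (vwk u)) (cong (m-reduct (LAbs-vren (extR ρ) p)) (vren-extR-vwk ρ u)))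

vsub0-vren : ∀ {n m} (ρ : Ren n m) v t →
             vren ρ (vsub (vsub0 v) t) ≡ vsub (vsub0 (vren ρ v)) (vren (extR ρ) t)
vsub0-vren ρ v t = trans (vren-vsub ρ (vsub0 v) t)
  (trans (vsub-cong (λ { zero → refl ; (suc i) → refl }) t) (sym (vsub-vren (vsub0 (vren ρ v)) (extR ρ) t)))

e-reduct-vren : ∀ {n m} (ρ : Ren n m) t {a} (p : LVal a) →
                vren ρ (e-reduct t p) ≡ e-reduct (vren (extR ρ) t) (LVal-vren ρ p)
e-reduct-vren ρ t {v} (val _) = vsub0-vren ρ v t
e-reduct-vren ρ t (val-es w p) = cong (λ z → es z (vren ρ w))
  (trans (e-reduct-vren (extR ρ) (vren (extR suc) t) p)
         (cong (λ z → e-reduct z (LVal-vren (extR ρ) p)) (vren-commute (λ { zero → refl ; (suc i) → refl }) t)))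

⟶-vren : ∀ {n m} (ρ : Ren n m) {r a b} → a ⟶[ r ] b → vren ρ a ⟶[ r ] vren ρ b
⟶-vren ρ (m-root {a} p u) =
  subst (app (vren ρ a) (vren ρ u) ⟶[ 𝕞 ]_) (sym (m-reduct-vren ρ p u)) (m-root (LAbs-vren ρ p) _)
⟶-vren ρ (e-root t {a} p) =
  subst (es (vren (extR ρ) t) (vren ρ a) ⟶[ 𝕖 ]_) (sym (e-reduct-vren ρ t p)) (e-root _ (LVal-vren ρ p))
⟶-vren ρ (appR t s) = appR _ (⟶-vren ρ s)
⟶-vren ρ (appL u s) = appL _ (⟶-vren ρ s)
⟶-vren ρ (esL u s)  = esL _ (⟶-vren (extR ρ) s)
⟶-vren ρ (esR t s)  = esR _ (⟶-vren ρ s)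

⟶-unvren : ∀ {n m} (ρ : Ren n m) {r} a {b} → vren ρ a ⟶[ r ] b →
           Σ (VTm n) λ a' → (a ⟶[ r ] a') × (b ≡ vren ρ a')
⟶-unvren ρ (app a u) (m-root p _) = let q = LAbs-unvren ρ a p in
  m-reduct q u , m-root q u , trans (m-reduct-irr p (LAbs-vren ρ q) _) (sym (m-reduct-vren ρ q u))
⟶-unvren ρ (es t a) (e-root _ p) = let q = LVal-unvren ρ a p in
  e-reduct t q , e-root t q , trans (e-reduct-irr _ p (LVal-vren ρ q)) (sym (e-reduct-vren ρ t q))
⟶-unvren ρ (app a u) (appR _ s) with ⟶-unvren ρ u s
... | u' , s' , refl = app a u' , appR a s' , refl
⟶-unvren ρ (app a u) (appL _ s) with ⟶-unvren ρ a s
... | a' , s' , refl = app a' u , appL u s' , refl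
⟶-unvren ρ (es t u) (esL _ s) with ⟶-unvren (extR ρ) t s
... | t' , s' , refl = es t' u , esL u s' , refl
⟶-unvren ρ (es t u) (esR _ s) with ⟶-unvren ρ u s
... | u' , s' , refl = es t u' , esR t s' , refl

infixr 4 _∙_
_∙_ : ∀ {n} {a b c : VTm n} → a ≡str b → b ≡str c → a ≡str c
_∙_ = ≡trans

≡⇒≡str : ∀ {n} {a b : VTm n} → a ≡ b → a ≡str b
≡⇒≡str refl = ≡refl

vren-swap01-vwk² : ∀ {n} (x : VTm n) → vren swap01 (vwk (vwk x)) ≡ vwk (vwk x)
vren-swap01-vwk² x = trans (vren-∘ swap01 suc (vwk x)) (vren-commute (λ _ → refl) x)

vren-swap01² : ∀ {n} (t : VTm (suc (suc n))) → vren swap01 (vren swap01 t) ≡ t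
vren-swap01² t = trans (vren-vren (λ { zero → refl ; (suc zero) → refl ; (suc (suc i)) → refl }) t) (vren-id t)

≡str-vsub : ∀ {n m} (σ : VSub n m) {a b} → a ≡str b → vsub σ a ≡str vsub σ b
≡str-vsub σ (ax-com t s u) =
  ≡⇒≡str (cong (λ z → es (es _ z) _) (vsub-vwk σ s)) ∙ ax-com _ _ _ ∙
  ≡⇒≡str (cong₂ (λ z w → es (es z w) (vsub σ s)) (sym (vsub-vren-commute swap-lift t)) (sym (vsub-vwk σ u)))
  where
    swap-lift : vextS (vextS σ) ∘ swap01 ≗ vren swap01 ∘ vextS (vextS σ)
    swap-lift zero          = refl
    swap-lift (suc zero)    = refl
    swap-lift (suc (suc i)) = sym (vren-swap01-vwk² (σ i))
≡str-vsub σ (ax-appr t s u) = ax-appr _ _ _ ∙ ≡⇒≡str (cong (λ z → es (app z _) _) (sym (vsub-vwk σ t)))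
≡str-vsub σ (ax-appl t u s) = ax-appl _ _ _ ∙ ≡⇒≡str (cong (λ z → es (app _ z) _) (sym (vsub-vwk σ s)))
≡str-vsub σ (ax-[·] t u s) =
  ax-[·] _ _ _ ∙ ≡⇒≡str (cong (λ z → es (es z _) _) (sym (vsub-vren-commute wk-lift t)))
  where
    wk-lift : vextS (vextS σ) ∘ extR suc ≗ vren (extR suc) ∘ vextS σ
    wk-lift zero    = refl
    wk-lift (suc i) = sym (vren-extR-vwk suc (σ i))
≡str-vsub σ ≡refl         = ≡refl
≡str-vsub σ (≡sym p)      = ≡sym (≡str-vsub σ p)
≡str-vsub σ (≡trans p q)  = ≡str-vsub σ p ∙ ≡str-vsub σ q
≡str-vsub σ (appR t p)    = appR _ (≡str-vsub σ p)
≡str-vsub σ (appL u p)    = appL _ (≡str-vsub σ p)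
≡str-vsub σ (esL u p)     = esL _ (≡str-vsub (vextS σ) p)
≡str-vsub σ (esR t p)     = esR _ (≡str-vsub σ p)

≡str-vren : ∀ {n m} (ρ : Ren n m) {a b} → a ≡str b → vren ρ a ≡str vren ρ b
≡str-vren ρ {a} {b} p =
  ≡⇒≡str (vren≗vsub ρ a) ∙ ≡str-vsub (var ∘ ρ) p ∙ ≡⇒≡str (sym (vren≗vsub ρ b))

m-reduct-cong : ∀ {n} {a : VTm n} (p : LAbs a) {u u'} → u ≡str u' → m-reduct p u ≡str m-reduct p u'
m-reduct-cong (abs t)      q = esR _ q
m-reduct-cong (abs-es w p) q = esL _ (m-reduct-cong p (≡str-vren suc q))

e-reduct-cong : ∀ {n} {t t'} {a : VTm n} (p : LVal a) → t ≡str t' → e-reduct t p ≡str e-reduct t' p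
e-reduct-cong (val _)      q = ≡str-vsub _ q
e-reduct-cong (val-es w p) q = esL _ (e-reduct-cong p (≡str-vren (extR suc) q))

m-reduct-≡ : ∀ {n} {a a' : VTm n} → a ≡ a' → (p : LAbs a) (p' : LAbs a') → ∀ {u u'} → u ≡ u' →
             m-reduct p u ≡ m-reduct p' u'
m-reduct-≡ refl p p' refl = m-reduct-irr p p' _

e-reduct-≡ : ∀ {n} {t t'} {a a' : VTm n} → t ≡ t' → a ≡ a' → (p : LVal a) (p' : LVal a') →
             e-reduct t p ≡ e-reduct t' p'
e-reduct-≡ refl refl p p' = e-reduct-irr _ p p'

e-reduct-ax-appl : ∀ {n} (t : VTm (suc n)) {u} (p : LVal u) s →
                   app (e-reduct t p) s ≡str e-reduct (app t (vwk s)) p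
e-reduct-ax-appl t (val _)      s = ≡⇒≡str (cong (app _) (sym (vsub0-vwk _ s)))
e-reduct-ax-appl t (val-es w p) s = ax-appl _ _ _ ∙ esL w (e-reduct-ax-appl _ p (vwk s))
  ∙ ≡⇒≡str (cong (λ z → es (e-reduct (app (vren (extR suc) t) z) p) w) (sym (vren-extR-vwk suc s)))

e-reduct-ax-appr : ∀ {n} (t : VTm n) s {u} (p : LVal u) →
                   app t (e-reduct s p) ≡str e-reduct (app (vwk t) s) p
e-reduct-ax-appr t s (val _)      = ≡⇒≡str (cong (λ z → app z _) (sym (vsub0-vwk _ t)))
e-reduct-ax-appr t s (val-es w p) = ax-appr _ _ _ ∙ esL w (e-reduct-ax-appr (vwk t) _ p)
  ∙ ≡⇒≡str (cong (λ z → es (e-reduct (app z (vren (extR suc) s)) p) w) (sym (vren-extR-vwk suc t)))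

e-reduct-ax-[·] : ∀ {n} (t : VTm (suc n)) u {s} (p : LVal s) →
                  es t (e-reduct u p) ≡str e-reduct (es (vren (extR suc) t) u) p
e-reduct-ax-[·] t u (val _) = ≡⇒≡str (cong (λ z → es z _) (sym (trans (vsub-vren _ (extR suc) t)
  (trans (vsub-cong (λ { zero → refl ; (suc i) → refl }) t) (vsub-var t)))))
e-reduct-ax-[·] t u (val-es w p) = ax-[·] _ _ _ ∙ esL w (e-reduct-ax-[·] (vren (extR suc) t) _ p)
  ∙ ≡⇒≡str (cong (λ z → es (e-reduct (es z (vren (extR suc) u)) p) w)
                 (vren-commute (λ { zero → refl ; (suc i) → refl }) t))

m-reduct-ax-appr : ∀ {n} {t : VTm n} (p : LAbs t) s u →
                   m-reduct p (es s u) ≡str es (m-reduct (LAbs-vren suc p) s) u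
m-reduct-ax-appr (abs b) s u = ax-[·] b s u
m-reduct-ax-appr {t = es t w} (abs-es w p) s u =
  esL w (m-reduct-ax-appr p (vren (extR suc) s) (vwk u))
  ∙ ≡⇒≡str (cong (λ z → es (es z (vwk u)) w) (sym swapped))
  ∙ ≡sym (ax-com _ w u)
  where
    swapped : vren swap01 (m-reduct (LAbs-vren (extR suc) p) (vwk s)) ≡ m-reduct (LAbs-vren suc p) (vren (extR suc) s)
    swapped = trans (m-reduct-vren swap01 (LAbs-vren (extR suc) p) (vwk s))
      (m-reduct-≡ (vren-vren (λ { zero → refl ; (suc i) → refl }) t) _ _
                  (vren-vren (λ { zero → refl ; (suc i) → refl }) s))

e-reduct-ax-com : ∀ {n} (T : VTm (suc (suc n))) {S} (q : LVal S) U →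
                  es (e-reduct T (LVal-vren suc q)) U ≡str e-reduct (es (vren swap01 T) (vwk U)) q
e-reduct-ax-com T (val _) U = ≡⇒≡str (cong₂ es
  (trans (vsub-cong (λ { zero → refl ; (suc zero) → refl ; (suc (suc i)) → refl }) T) (sym (vsub-vren _ swap01 T)))
  (sym (vsub0-vwk _ U)))
e-reduct-ax-com T {es a w} (val-es w q) U =
  ax-com X w U
  ∙ ≡⇒≡str (cong (λ z → es (es z (vwk U)) w) X-swapped)
  ∙ esL w (e-reduct-ax-com T' q (vwk U))
  ∙ ≡⇒≡str (cong (λ z → es z w) (e-reduct-≡ (cong₂ es T'-swapped (sym (vren-extR-vwk suc U))) refl q q))
  where
    X  = e-reduct (vren (extR suc) T) (LVal-vren (extR suc) q)
    T' = vren (extR swap01) (vren (extR suc) T)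
    X-swapped : vren swap01 X ≡ e-reduct T' (LVal-vren suc q)
    X-swapped = trans (e-reduct-vren swap01 (vren (extR suc) T) (LVal-vren (extR suc) q))
      (e-reduct-≡ refl (vren-vren (λ { zero → refl ; (suc i) → refl }) a)
                  (LVal-vren swap01 (LVal-vren (extR suc) q)) (LVal-vren suc q))
    T'-swapped : vren swap01 T' ≡ vren (extR (extR suc)) (vren swap01 T)
    T'-swapped = trans (vren-∘ swap01 (extR swap01) (vren (extR suc) T))
      (vren-commute (λ { zero → refl ; (suc zero) → refl ; (suc (suc i)) → refl }) T)

-- Structural equivalence is a strong bisimulation

-- Besides steps, simulations must match answers: root m- and e-redexes are
-- recognised by the shape of a subterm, which ≡str may rearrange.
AbsMatched : ∀ {n} → VTm n → VTm n → Set
AbsMatched a b = (p : LAbs a) → Σ (LAbs b) λ q → ∀ u → m-reduct p u ≡str m-reduct q u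

ValMatched : ∀ {n} → VTm n → VTm n → Set
ValMatched a b = (p : LVal a) → Σ (LVal b) λ q → ∀ t → e-reduct t p ≡str e-reduct t q

record _≼_ {n : ℕ} (a b : VTm n) : Set where
  field
    step   : ∀ {r a'} → a ⟶[ r ] a' → Σ (VTm n) λ b' → (b ⟶[ r ] b') × (a' ≡str b')
    absAns : AbsMatched a b
    valAns : ValMatched a b
open _≼_

absAns-back : ∀ {n} {a b : VTm n} → (LAbs b → LAbs a) → AbsMatched a b → AbsMatched b a
absAns-back g f p with f (g p)
... | q , e = g p , λ u → ≡sym (e u ∙ ≡⇒≡str (m-reduct-irr q p u))

valAns-back : ∀ {n} {a b : VTm n} → (LVal b → LVal a) → ValMatched a b → ValMatched b a
valAns-back g f p with f (g p)
... | q , e = g p , λ t → ≡sym (e t ∙ ≡⇒≡str (e-reduct-irr t q p))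

≼-refl : ∀ {n} {a : VTm n} → a ≼ a
≼-refl .step st  = _ , st , ≡refl
≼-refl .absAns p = p , λ _ → ≡refl
≼-refl .valAns p = p , λ _ → ≡refl

≼-trans : ∀ {n} {a b c : VTm n} → a ≼ b → b ≼ c → a ≼ c
≼-trans f g .step st with f .step st
... | _ , st' , e with g .step st'
... | c' , st'' , e' = c' , st'' , e ∙ e'
≼-trans f g .absAns p with f .absAns p
... | q , e with g .absAns q
... | q' , e' = q' , λ u → e u ∙ e' u
≼-trans f g .valAns p with f .valAns p
... | q , e with g .valAns q
... | q' , e' = q' , λ t → e t ∙ e' t

≼-com : ∀ {n} (t : VTm (suc (suc n))) s u → es (es t (vwk s)) u ≼ es (es (vren swap01 t) (vwk u)) s
≼-com t s u .step (esL _ (esL _ st)) = _ , esL _ (esL _ (⟶-vren swap01 st)) , ax-com _ s u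
≼-com t s u .step (esL _ (esR _ st)) with ⟶-unvren suc s st
... | s' , st' , refl = _ , esR _ st' , ax-com t s' u
≼-com t s u .step (esL _ (e-root _ p)) = let q = LVal-unvren suc s p in
  _ , e-root _ q , ≡⇒≡str (cong (λ z → es z u) (e-reduct-irr t p (LVal-vren suc q))) ∙ e-reduct-ax-com t q u
≼-com t s u .step (esR _ st) = _ , esL _ (esR _ (⟶-vren suc st)) , ax-com t s _
≼-com t s u .step (e-root _ p) = _ , esL _ (e-root _ (LVal-vren suc p)) ,
  ≡sym (e-reduct-ax-com (vren swap01 t) p s ∙ ≡⇒≡str (cong (λ z → e-reduct (es z (vwk s)) p) (vren-swap01² t)))
≼-com t s u .absAns (abs-es _ (abs-es _ p)) = abs-es _ (abs-es _ (LAbs-vren swap01 p)) , λ x →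
  ax-com _ s u ∙ ≡⇒≡str (cong (λ z → es (es z _) s)
    (trans (m-reduct-vren swap01 p (vwk (vwk x))) (cong (m-reduct (LAbs-vren swap01 p)) (vren-swap01-vwk² x))))
≼-com t s u .valAns (val-es _ (val-es _ p)) = val-es _ (val-es _ (LVal-vren swap01 p)) , λ T →
  ax-com _ s u ∙ ≡⇒≡str (cong (λ z → es (es z _) s)
    (trans (e-reduct-vren swap01 _ p)
           (e-reduct-≡ (trans (vren-∘ (extR swap01) (extR suc) (vren (extR suc) T))
                              (vren-commute (λ { zero → refl ; (suc i) → refl }) T))
                       refl (LVal-vren swap01 p) (LVal-vren swap01 p))))

≼-com⁻ : ∀ {n} (t : VTm (suc (suc n))) s u → es (es (vren swap01 t) (vwk u)) s ≼ es (es t (vwk s)) u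
≼-com⁻ t s u = subst (λ z → es (es (vren swap01 t) (vwk u)) s ≼ es (es z (vwk s)) u)
                     (vren-swap01² t) (≼-com (vren swap01 t) u s)

≼-[·] : ∀ {n} (t : VTm (suc n)) u s → es t (es u s) ≼ es (es (vren (extR suc) t) u) s
≼-[·] t u s .step (esL _ st)         = _ , esL _ (esL _ (⟶-vren (extR suc) st)) , ax-[·] _ u s
≼-[·] t u s .step (esR _ (esL _ st)) = _ , esL _ (esR _ st) , ax-[·] t _ s
≼-[·] t u s .step (esR _ (esR _ st)) = _ , esR _ st , ax-[·] t u _
≼-[·] t u s .step (esR _ (e-root _ p)) = _ , e-root _ p , e-reduct-ax-[·] t u p
≼-[·] t u s .step (e-root _ (val-es _ p)) = _ , esL _ (e-root _ p) , ≡refl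
≼-[·] t u s .absAns (abs-es _ p) = abs-es _ (abs-es _ (LAbs-vren (extR suc) p)) , λ x →
  ax-[·] _ u s ∙ ≡⇒≡str (cong (λ z → es (es z u) s)
    (trans (m-reduct-vren (extR suc) p (vwk x)) (cong (m-reduct (LAbs-vren (extR suc) p)) (vren-extR-vwk suc x))))
≼-[·] t u s .valAns (val-es _ p) = val-es _ (val-es _ (LVal-vren (extR suc) p)) , λ T →
  ax-[·] _ u s ∙ ≡⇒≡str (cong (λ z → es (es z u) s)
    (trans (e-reduct-vren (extR suc) _ p)
           (e-reduct-≡ (vren-commute (λ { zero → refl ; (suc i) → refl }) T) refl
                       (LVal-vren (extR suc) p) (LVal-vren (extR suc) p))))

≼-[·]⁻ : ∀ {n} (t : VTm (suc n)) u s → es (es (vren (extR suc) t) u) s ≼ es t (es u s)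
≼-[·]⁻ t u s .step (esL _ (esL _ st)) with ⟶-unvren (extR suc) t st
... | t' , st' , refl = _ , esL _ st' , ≡sym (ax-[·] t' u s)
≼-[·]⁻ t u s .step (esL _ (esR _ st)) = _ , esR _ (esL _ st) , ≡sym (ax-[·] t _ s)
≼-[·]⁻ t u s .step (esL _ (e-root _ p)) = _ , e-root _ (val-es s p) , ≡refl
≼-[·]⁻ t u s .step (esR _ st) = _ , esR _ (esR _ st) , ≡sym (ax-[·] t u _)
≼-[·]⁻ t u s .step (e-root _ p) = _ , esR _ (e-root _ p) , ≡sym (e-reduct-ax-[·] t u p)
≼-[·]⁻ t u s .absAns = absAns-back (λ { (abs-es _ (abs-es _ p)) → abs-es _ (LAbs-unvren (extR suc) t p) })
                                   (≼-[·] t u s .absAns)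
≼-[·]⁻ t u s .valAns = valAns-back (λ { (val-es _ (val-es _ p)) → val-es _ (LVal-unvren (extR suc) t p) })
                                   (≼-[·] t u s .valAns)

≼-appl : ∀ {n} (t : VTm (suc n)) u s → app (es t u) s ≼ es (app t (vwk s)) u
≼-appl t u s .step (appR _ st)         = _ , esL _ (appR _ (⟶-vren suc st)) , ax-appl t u _
≼-appl t u s .step (appL _ (esL _ st)) = _ , esL _ (appL _ st) , ax-appl _ u s
≼-appl t u s .step (appL _ (esR _ st)) = _ , esR _ st , ax-appl t _ s
≼-appl t u s .step (appL _ (e-root _ p)) = _ , e-root _ p , e-reduct-ax-appl t p s
≼-appl t u s .step (m-root (abs-es _ p) _) = _ , esL _ (m-root p _) , ≡refl
≼-appl t u s .absAns ()
≼-appl t u s .valAns (val ())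

≼-appl⁻ : ∀ {n} (t : VTm (suc n)) u s → es (app t (vwk s)) u ≼ app (es t u) s
≼-appl⁻ t u s .step (esL _ (appL _ st)) = _ , appL _ (esL _ st) , ≡sym (ax-appl _ u s)
≼-appl⁻ t u s .step (esL _ (appR _ st)) with ⟶-unvren suc s st
... | s' , st' , refl = _ , appR _ st' , ≡sym (ax-appl t u s')
≼-appl⁻ t u s .step (esL _ (m-root p _)) = _ , m-root (abs-es _ p) s , ≡refl
≼-appl⁻ t u s .step (esR _ st) = _ , appL _ (esR _ st) , ≡sym (ax-appl t _ s)
≼-appl⁻ t u s .step (e-root _ p) = _ , appL _ (e-root _ p) , ≡sym (e-reduct-ax-appl t p s)
≼-appl⁻ t u s .absAns (abs-es _ ())
≼-appl⁻ t u s .valAns (val ())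
≼-appl⁻ t u s .valAns (val-es _ (val ()))

≼-appr : ∀ {n} (t : VTm n) s u → app t (es s u) ≼ es (app (vwk t) s) u
≼-appr t s u .step (appL _ st)         = _ , esL _ (appL _ (⟶-vren suc st)) , ax-appr _ s u
≼-appr t s u .step (appR _ (esL _ st)) = _ , esL _ (appR _ st) , ax-appr t _ u
≼-appr t s u .step (appR _ (esR _ st)) = _ , esR _ st , ax-appr t s _
≼-appr t s u .step (appR _ (e-root _ p)) = _ , e-root _ p , e-reduct-ax-appr t s p
≼-appr t s u .step (m-root p _) = _ , esL _ (m-root (LAbs-vren suc p) s) , m-reduct-ax-appr p s u
≼-appr t s u .absAns ()
≼-appr t s u .valAns (val ())

≼-appr⁻ : ∀ {n} (t : VTm n) s u → es (app (vwk t) s) u ≼ app t (es s u)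
≼-appr⁻ t s u .step (esL _ (appL _ st)) with ⟶-unvren suc t st
... | t' , st' , refl = _ , appL _ st' , ≡sym (ax-appr t' s u)
≼-appr⁻ t s u .step (esL _ (appR _ st)) = _ , appR _ (esL _ st) , ≡sym (ax-appr t _ u)
≼-appr⁻ t s u .step (esL _ (m-root p _)) = let q = LAbs-unvren suc t p in
  _ , m-root q _ , ≡sym (m-reduct-ax-appr q s u ∙ ≡⇒≡str (cong (λ z → es z u) (m-reduct-irr _ p s)))
≼-appr⁻ t s u .step (esR _ st) = _ , appR _ (esR _ st) , ≡sym (ax-appr t s _)
≼-appr⁻ t s u .step (e-root _ p) = _ , appR _ (e-root _ p) , ≡sym (e-reduct-ax-appr t s p)
≼-appr⁻ t s u .absAns (abs-es _ ())
≼-appr⁻ t s u .valAns (val ())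
≼-appr⁻ t s u .valAns (val-es _ (val ()))

≼-appR : ∀ {n} (t : VTm n) {u u'} → u ≡str u' → u ≼ u' → app t u ≼ app t u'
≼-appR t e f .step (appR _ st) with f .step st
... | _ , st' , e' = _ , appR t st' , appR t e'
≼-appR t e f .step (appL _ st)   = _ , appL _ st , appR _ e
≼-appR t e f .step (m-root p _)  = _ , m-root p _ , m-reduct-cong p e
≼-appR t e f .absAns ()
≼-appR t e f .valAns (val ())

≼-appL : ∀ {n} (u : VTm n) {t t'} → t ≡str t' → t ≼ t' → app t u ≼ app t' u
≼-appL u e f .step (appL _ st) with f .step st
... | _ , st' , e' = _ , appL u st' , appL u e'
≼-appL u e f .step (appR _ st) = _ , appR _ st , appL _ e
≼-appL u e f .step (m-root p _) with f .absAns p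
... | q , e' = _ , m-root q u , e' u
≼-appL u e f .absAns ()
≼-appL u e f .valAns (val ())

≼-esL : ∀ {n} (u : VTm n) {t t'} → t ≡str t' → t ≼ t' → es t u ≼ es t' u
≼-esL u e f .step (esL _ st) with f .step st
... | _ , st' , e' = _ , esL u st' , esL u e'
≼-esL u e f .step (esR _ st)   = _ , esR _ st , esL _ e
≼-esL u e f .step (e-root _ p) = _ , e-root _ p , e-reduct-cong p e
≼-esL u e f .absAns (abs-es _ p) with f .absAns p
... | q , e' = abs-es u q , λ x → esL u (e' (vwk x))
≼-esL u e f .valAns (val-es _ p) with f .valAns p
... | q , e' = val-es u q , λ x → esL u (e' (vren (extR suc) x))

≼-esR : ∀ {n} (t : VTm (suc n)) {u u'} → u ≡str u' → u ≼ u' → es t u ≼ es t u'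
≼-esR t e f .step (esR _ st) with f .step st
... | _ , st' , e' = _ , esR t st' , esR t e'
≼-esR t e f .step (esL _ st) = _ , esL _ st , esR _ e
≼-esR t e f .step (e-root _ p) with f .valAns p
... | q , e' = _ , e-root t q , e' t
≼-esR t e f .absAns (abs-es _ p) = abs-es _ p , λ _ → esR _ e
≼-esR t e f .valAns (val-es _ p) = val-es _ p , λ _ → esR _ e

≡str-bisim : ∀ {n} {a b : VTm n} → a ≡str b → a ≼ b × b ≼ a
≡str-bisim (ax-com t s u)  = ≼-com t s u , ≼-com⁻ t s u
≡str-bisim (ax-appr t s u) = ≼-appr t s u , ≼-appr⁻ t s u
≡str-bisim (ax-appl t u s) = ≼-appl t u s , ≼-appl⁻ t u s
≡str-bisim (ax-[·] t u s)  = ≼-[·] t u s , ≼-[·]⁻ t u s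
≡str-bisim ≡refl           = ≼-refl , ≼-refl
≡str-bisim (≡sym p)        = proj₂ (≡str-bisim p) , proj₁ (≡str-bisim p)
≡str-bisim (≡trans p q)    = ≼-trans (proj₁ (≡str-bisim p)) (proj₁ (≡str-bisim q))
                           , ≼-trans (proj₂ (≡str-bisim q)) (proj₂ (≡str-bisim p))
≡str-bisim (appR t p) = ≼-appR t p (proj₁ (≡str-bisim p)) , ≼-appR t (≡sym p) (proj₂ (≡str-bisim p))
≡str-bisim (appL u p) = ≼-appL u p (proj₁ (≡str-bisim p)) , ≼-appL u (≡sym p) (proj₂ (≡str-bisim p))
≡str-bisim (esL u p)  = ≼-esL u p (proj₁ (≡str-bisim p)) , ≼-esL u (≡sym p) (proj₂ (≡str-bisim p))
≡str-bisim (esR t p)  = ≼-esR t p (proj₁ (≡str-bisim p)) , ≼-esR t (≡sym p) (proj₂ (≡str-bisim p))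

infixr 5 _++_
_++_ : ∀ {n} {a b c : VTm n} → VsubDeriv a b → VsubDeriv b c → VsubDeriv a c
[]      ++ e = e
(s ∷ d) ++ e = s ∷ (d ++ e)

e-count-++ : ∀ {n} {a b c : VTm n} (d : VsubDeriv a b) (e : VsubDeriv b c) →
             e-count (d ++ e) ≡ e-count d + e-count e
e-count-++ []                e = refl
e-count-++ (_∷_ {r = 𝕖} s d) e = cong suc (e-count-++ d e)
e-count-++ (_∷_ {r = 𝕞} s d) e = e-count-++ d e

e-count-∷ : ∀ {n n' r} {a b c : VTm n} {a' b' c' : VTm n'} (s : a ⟶vsub[ r ] b) (s' : a' ⟶vsub[ r ] b')
            {d : VsubDeriv b c} {d' : VsubDeriv b' c'} →
            e-count d ≡ e-count d' → e-count (s ∷ d) ≡ e-count (s' ∷ d')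
e-count-∷ {r = 𝕞} s s' eq = eq
e-count-∷ {r = 𝕖} s s' eq = cong suc eq

module _ {n m} (f : VTm n → VTm m) (f-step : ∀ {r a b} → a ⟶vsub[ r ] b → f a ⟶vsub[ r ] f b) where

  map-VsubDeriv : ∀ {a b} → VsubDeriv a b → VsubDeriv (f a) (f b)
  map-VsubDeriv []      = []
  map-VsubDeriv (s ∷ d) = f-step s ∷ map-VsubDeriv d

  e-count-map : ∀ {a b} (d : VsubDeriv a b) → e-count (map-VsubDeriv d) ≡ e-count d
  e-count-map []      = refl
  e-count-map (s ∷ d) = e-count-∷ (f-step s) s (e-count-map d)

map-⟶m* : ∀ {n m} (f : VTm n → VTm m) → (∀ {a b} → a ⟶m b → f a ⟶m f b) →
          ∀ {a b} → a ⟶m* b → f a ⟶m* f b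
map-⟶m* f f-step []      = []
map-⟶m* f f-step (s ∷ d) = f-step s ∷ map-⟶m* f f-step d

_++m_ : ∀ {n} {a b c : VTm n} → a ⟶m* b → b ⟶m* c → a ⟶m* c
[]      ++m e = e
(s ∷ d) ++m e = s ∷ (d ++m e)

⟶m*⇒VsubDeriv : ∀ {n} {a b : VTm n} → a ⟶m* b → VsubDeriv a b
⟶m*⇒VsubDeriv []      = []
⟶m*⇒VsubDeriv (s ∷ d) = s ∷ ⟶m*⇒VsubDeriv d

e-count-⟶m* : ∀ {n} {a b : VTm n} (d : a ⟶m* b) → e-count (⟶m*⇒VsubDeriv d) ≡ 0
e-count-⟶m* []      = refl
e-count-⟶m* (s ∷ d) = e-count-⟶m* d

≡str-postpone : ∀ {n} {a b c : VTm n} → a ≡str b → (e : VsubDeriv b c) →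
                Σ (VTm n) λ a' → Σ (VsubDeriv a a') λ e' → (a' ≡str c) × (e-count e' ≡ e-count e)
≡str-postpone eq [] = _ , [] , eq , refl
≡str-postpone eq (s ∷ e) with proj₂ (≡str-bisim eq) .step (⟶vsub⇒⟶ s)
... | _ , s' , eq' with ≡str-postpone (≡sym eq') e
... | a' , e' , eq'' , count = a' , ⟶⇒⟶vsub s' ∷ e' , eq'' , e-count-∷ (⟶⇒⟶vsub s') s count

-- Termination of →m

#app : ∀ {n} → VTm n → ℕ
#app (var x)   = 0
#app (lam t)   = #app t
#app (app t u) = suc (#app t + #app u)
#app (es t u)  = #app t + #app u

#app-vren : ∀ {n m} (ρ : Ren n m) t → #app (vren ρ t) ≡ #app t
#app-vren ρ (var x)   = refl
#app-vren ρ (lam t)   = #app-vren (extR ρ) t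
#app-vren ρ (app t u) = cong₂ (λ a b → suc (a + b)) (#app-vren ρ t) (#app-vren ρ u)
#app-vren ρ (es t u)  = cong₂ _+_ (#app-vren (extR ρ) t) (#app-vren ρ u)

#app-m-reduct : ∀ {n} {a : VTm n} (p : LAbs a) u → #app (m-reduct p u) ≡ #app a + #app u
#app-m-reduct (abs t) u = refl
#app-m-reduct {a = es a w} (abs-es w p) u = begin
  #app (m-reduct p (vwk u)) + #app w ≡⟨ cong (_+ #app w) (#app-m-reduct p (vwk u)) ⟩
  (#app a + #app (vwk u)) + #app w   ≡⟨ cong (λ k → (#app a + k) + #app w) (#app-vren suc u) ⟩
  (#app a + #app u) + #app w         ≡⟨ xy∙z≈xz∙y (#app a) (#app u) (#app w) ⟩
  (#app a + #app w) + #app u         ∎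
  where open ≡-Reasoning

#app-decreases : ∀ {n} {a b : VTm n} → a ⟶[ 𝕞 ] b → #app b < #app a
#app-decreases (m-root {a} p u) = subst (_< suc (#app a + #app u)) (sym (#app-m-reduct p u)) (n<1+n _)
#app-decreases (appR t s) = s≤s (+-monoʳ-< (#app t) (#app-decreases s))
#app-decreases (appL u s) = s≤s (+-monoˡ-< (#app u) (#app-decreases s))
#app-decreases (esL u s)  = +-monoˡ-< (#app u) (#app-decreases s)
#app-decreases (esR t s)  = +-monoʳ-< (#app t) (#app-decreases s)

LAbs? : ∀ {n} (a : VTm n) → Dec (LAbs a)
LAbs? (var x)   = no λ ()
LAbs? (lam t)   = yes (abs t)
LAbs? (app a b) = no λ ()
LAbs? (es a b) with LAbs? a
... | yes p = yes (abs-es b p)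
... | no ¬p = no λ { (abs-es _ p) → ¬p p }

⟶m-normal : ∀ {n} → VTm n → Set
⟶m-normal a = ∀ b → ¬ a ⟶[ 𝕞 ] b

⟶m-progress : ∀ {n} (a : VTm n) → (Σ (VTm n) λ b → a ⟶[ 𝕞 ] b) ⊎ ⟶m-normal a
⟶m-progress (var x) = inj₂ λ _ ()
⟶m-progress (lam t) = inj₂ λ _ ()
⟶m-progress (app a b) with LAbs? a | ⟶m-progress a | ⟶m-progress b
... | yes p | _             | _             = inj₁ (_ , m-root p b)
... | no _  | inj₁ (_ , s)  | _             = inj₁ (_ , appL b s)
... | no _  | inj₂ _        | inj₁ (_ , s)  = inj₁ (_ , appR a s)
... | no ¬p | inj₂ na       | inj₂ nb       =
  inj₂ λ { _ (m-root p _) → ¬p p ; _ (appL _ s) → na _ s ; _ (appR _ s) → nb _ s }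
⟶m-progress (es a b) with ⟶m-progress a | ⟶m-progress b
... | inj₁ (_ , s) | _            = inj₁ (_ , esL b s)
... | inj₂ _       | inj₁ (_ , s) = inj₁ (_ , esR a s)
... | inj₂ na      | inj₂ nb      = inj₂ λ { _ (esL _ s) → na _ s ; _ (esR _ s) → nb _ s }

m-normalise : ∀ {n} (a : VTm n) → Σ (VTm n) (IsMnf a)
m-normalise {n} a = go a (<-wellFounded (#app a))
  where
    go : (a : VTm n) → Acc _<_ (#app a) → Σ (VTm n) (IsMnf a)
    go a (acc rs) with ⟶m-progress a
    ... | inj₂ na = a , [] , λ b s → na b (⟶vsub⇒⟶ s)
    ... | inj₁ (a' , s) with go a' (rs (#app-decreases s))
    ... | b , d , nb = b , ⟶⇒⟶vsub s ∷ d , nb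

-- Simulating shuffling derivations

infix 4 _⊳_
data _⊳_ {n : ℕ} : Tm n → VTm n → Set where
  ⊳var : ∀ x → var x ⊳ var x
  ⊳lam : ∀ t → lam t ⊳ lam ⌜ t ⌝
  ⊳app : ∀ {a a' b b'} → a ⊳ a' → b ⊳ b' → app a b ⊳ app a' b'
  ⊳es  : ∀ {a a' b b'} → a ⊳ a' → b ⊳ b' → app (lam a) b ⊳ es a' b'

⊳-refl : ∀ {n} (t : Tm n) → t ⊳ ⌜ t ⌝
⊳-refl (var x)   = ⊳var x
⊳-refl (lam t)   = ⊳lam t
⊳-refl (app t u) = ⊳app (⊳-refl t) (⊳-refl u)

⊳-ren : ∀ {n m} (ρ : Ren n m) {a w} → a ⊳ w → ren ρ a ⊳ vren ρ w
⊳-ren ρ (⊳var x)   = ⊳var _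
⊳-ren ρ (⊳lam t)   = subst (λ z → lam (ren (extR ρ) t) ⊳ lam z) (⌜ren⌝ (extR ρ) t) (⊳lam _)
⊳-ren ρ (⊳app a b) = ⊳app (⊳-ren ρ a) (⊳-ren ρ b)
⊳-ren ρ (⊳es a b)  = ⊳es (⊳-ren (extR ρ) a) (⊳-ren ρ b)

⊳-sub : ∀ {n m} (σ : Sub n m) {a w} → a ⊳ w → sub σ a ⊳ vsub (⌜_⌝ ∘ σ) w
⊳-sub σ (⊳var x)   = ⊳-refl (σ x)
⊳-sub σ (⊳lam t)   = subst (sub σ (lam t) ⊳_) (⌜sub⌝ σ (lam t)) (⊳-refl _)
⊳-sub σ (⊳app a b) = ⊳app (⊳-sub σ a) (⊳-sub σ b)
⊳-sub σ (⊳es {a' = a'} a b) = ⊳es (subst (_ ⊳_) (vsub-cong (⌜extS⌝ σ) a') (⊳-sub (extS σ) a)) (⊳-sub σ b)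

⊳-value : ∀ {n} {v : Tm n} {w} → IsValue v → v ⊳ w → w ≡ ⌜ v ⌝
⊳-value (var-val x) (⊳var .x) = refl
⊳-value (lam-val t) (⊳lam .t) = refl

⊳-βv : ∀ {n} {t : Tm (suc n)} {t'} {v : Tm n} → t ⊳ t' → (iv : IsValue v) →
       Σ (LVal ⌜ v ⌝) λ p → t [ v ]₀ ⊳ e-reduct t' p
⊳-βv {t' = t'} tt' (var-val x) =
  val (var-val x) , subst (_ ⊳_) (vsub-cong (λ { zero → refl ; (suc i) → refl }) t') (⊳-sub _ tt')
⊳-βv {t' = t'} tt' (lam-val b) =
  val (lam-val _) , subst (_ ⊳_) (vsub-cong (λ { zero → refl ; (suc i) → refl }) t') (⊳-sub _ tt')

record Reaches {n : ℕ} (w : VTm n) (k : ℕ) (u : Tm n) : Set where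
  constructor reaches
  field
    {end image} : VTm n
    deriv       : VsubDeriv w end
    related     : u ⊳ image
    equivalent  : end ≡str image
    e-steps     : e-count deriv ≡ k

Reaches-map : ∀ {n m} {w k u} (f : VTm n → VTm m) (F : Tm n → Tm m) →
              (∀ {r a b} → a ⟶vsub[ r ] b → f a ⟶vsub[ r ] f b) → (∀ {x y} → x ⊳ y → F x ⊳ f y) →
              (∀ {x y} → x ≡str y → f x ≡str f y) → Reaches w k u → Reaches (f w) k (F u)
Reaches-map f F f-step f-⊳ f-≡str (reaches e rel eq count) =
  reaches (map-VsubDeriv f f-step e) (f-⊳ rel) (f-≡str eq) (trans (e-count-map f f-step e) count)

Reaches-≡str : ∀ {n} {a w : VTm n} {k u} → a ≡str w → Reaches w k u → Reaches a k u
Reaches-≡str eq (reaches e rel eq' count) with ≡str-postpone eq e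
... | _ , e' , eq'' , count' = reaches e' rel (eq'' ∙ eq') (trans count' count)

m-step : ∀ {n} {a : VTm n} (p : LAbs a) u → app a u ⟶vsub[ 𝕞 ] m-reduct p u
m-step p u = ⟶⇒⟶vsub (m-root p u)

βv-weight : ShufRule → ℕ
βv-weight βv = 1
βv-weight σ₁ = 0
βv-weight σ₃ = 0

⊳-step : ∀ {n} {u u' : Tm n} {r} → u ⟶shuf[ r ] u' → ∀ {w} → u ⊳ w → Reaches w (βv-weight r) u'
⊳-step (root-σ₁ t a s) (⊳app (⊳app (⊳lam .t) ra) rs) =
  reaches (appL _ (m-step (abs ⌜ t ⌝) _) ∷ []) (⊳es (⊳app (⊳-refl t) (⊳-ren suc rs)) ra) (ax-appl _ _ _) refl
⊳-step (root-σ₁ t a s) (⊳app (⊳es rt ra) rs) =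
  reaches [] (⊳es (⊳app rt (⊳-ren suc rs)) ra) (ax-appl _ _ _) refl
⊳-step (root-σ₃ v iv s a) (⊳app rv (⊳app (⊳lam .s) ra)) =
  reaches (appR _ (m-step (abs ⌜ s ⌝) _) ∷ []) (⊳es (⊳app (⊳-ren suc rv) (⊳-refl s)) ra) (ax-appr _ _ _) refl
⊳-step (root-σ₃ v iv s a) (⊳app rv (⊳es rs ra)) =
  reaches [] (⊳es (⊳app (⊳-ren suc rv) rs) ra) (ax-appr _ _ _) refl
⊳-step (root-σ₃ _ iv s a) (⊳es rb (⊳app (⊳lam .s) ra)) =
  reaches (esR _ (m-step (abs ⌜ s ⌝) _) ∷ []) (⊳es (⊳es (⊳-ren (extR suc) rb) (⊳-refl s)) ra)
          (ax-[·] _ _ _) refl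
⊳-step (root-σ₃ _ iv s a) (⊳es rb (⊳es rs ra)) =
  reaches [] (⊳es (⊳es (⊳-ren (extR suc) rb) rs) ra) (ax-[·] _ _ _) refl
⊳-step (root-βv t v iv) (⊳app (⊳lam .t) rv) with ⊳-value iv rv | ⊳-βv (⊳-refl t) iv
... | refl | p , rel = reaches (m-step (abs ⌜ t ⌝) _ ∷ (⟶⇒⟶vsub (e-root _ p) ∷ [])) rel ≡refl refl
⊳-step (root-βv t v iv) (⊳es rt rv) with ⊳-value iv rv | ⊳-βv rt iv
... | refl | p , rel = reaches (⟶⇒⟶vsub (e-root _ p) ∷ []) rel ≡refl refl
⊳-step (appR t st) (⊳app {a' = t'} rt rb) =
  Reaches-map (app t') (app t) (appR t') (⊳app rt) (appR t') (⊳-step st rb)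
⊳-step (appR _ st) (⊳es {a = a} {a' = a'} rt rb) =
  Reaches-map (es a') (app (lam a)) (esR a') (⊳es rt) (esR a') (⊳-step st rb)
⊳-step (appL u st) (⊳app {b = b} {b' = b'} ra rb) =
  Reaches-map (λ z → app z b') (λ z → app z b) (appL b') (λ x → ⊳app x rb) (appL b') (⊳-step st ra)
⊳-step (appL u ()) (⊳es ra rb)
⊳-step (lamApp {t = t} u st) (⊳app {b = b} {b' = b'} (⊳lam .t) rb)
  with Reaches-map (λ z → es z b') (λ z → app (lam z) b) (esL b') (λ x → ⊳es x rb) (esL b')
                   (⊳-step st (⊳-refl t))
... | reaches e rel eq count = reaches (m-step (abs ⌜ t ⌝) _ ∷ e) rel eq count
⊳-step (lamApp u st) (⊳es {b = b} {b' = b'} rt rb) =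
  Reaches-map (λ z → es z b') (λ z → app (lam z) b) (esL b') (λ x → ⊳es x rb) (esL b') (⊳-step st rt)

βv-count-∷ : ∀ {n r} {t t' u : Tm n} (s : t ⟶shuf[ r ] t') (d : ShufDeriv t' u) →
             βv-count (s ∷ d) ≡ βv-weight r + βv-count d
βv-count-∷ {r = βv} s d = refl
βv-count-∷ {r = σ₁} s d = refl
βv-count-∷ {r = σ₃} s d = refl

⊳-simulation : ∀ {n} {u v : Tm n} (d : ShufDeriv u v) {w} → u ⊳ w → Reaches w (βv-count d) v
⊳-simulation [] rel = reaches [] rel ≡refl refl
⊳-simulation (s ∷ d) rel with ⊳-step s rel
... | reaches e₁ rel₁ eq₁ count₁ with Reaches-≡str eq₁ (⊳-simulation d rel₁)
... | reaches e₂ rel₂ eq₂ count₂ = reaches (e₁ ++ e₂) rel₂ eq₂ (begin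
  e-count (e₁ ++ e₂)        ≡⟨ e-count-++ e₁ e₂ ⟩
  e-count e₁ + e-count e₂   ≡⟨ cong₂ _+_ count₁ count₂ ⟩
  βv-weight _ + βv-count d  ≡⟨ sym (βv-count-∷ s d) ⟩
  βv-count (s ∷ d)          ∎)
  where open ≡-Reasoning

-- Shuffling normal forms

esForm : ∀ {n} → Tm n → VTm n
esForm (var x)           = var x
esForm (lam t)           = lam ⌜ t ⌝
esForm (app (lam t) b)   = es (esForm t) (esForm b)
esForm (app (var x) b)   = app (var x) (esForm b)
esForm (app (app a c) b) = app (esForm (app a c)) (esForm b)

⊳-⟶m*-esForm : ∀ {n} {u : Tm n} {w} → u ⊳ w → w ⟶m* esForm u
⊳-⟶m*-esForm (⊳var x) = []
⊳-⟶m*-esForm (⊳lam t) = []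
⊳-⟶m*-esForm (⊳app {b' = b'} (⊳lam t) rb) = m-step (abs ⌜ t ⌝) b' ∷
  (map-⟶m* (λ z → es z b') (esL _) (⊳-⟶m*-esForm (⊳-refl t))
   ++m map-⟶m* (es (esForm t)) (esR _) (⊳-⟶m*-esForm rb))
⊳-⟶m*-esForm (⊳app (⊳var x) rb) = map-⟶m* (app (var x)) (appR _) (⊳-⟶m*-esForm rb)
⊳-⟶m*-esForm (⊳app {b' = b'} ra@(⊳app _ _) rb) =
  map-⟶m* (λ z → app z b') (appL _) (⊳-⟶m*-esForm ra) ++m map-⟶m* (app (esForm _)) (appR _) (⊳-⟶m*-esForm rb)
⊳-⟶m*-esForm (⊳app {b' = b'} ra@(⊳es _ _) rb) =
  map-⟶m* (λ z → app z b') (appL _) (⊳-⟶m*-esForm ra) ++m map-⟶m* (app (esForm _)) (appR _) (⊳-⟶m*-esForm rb)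
⊳-⟶m*-esForm (⊳es {b' = b'} ra rb) =
  map-⟶m* (λ z → es z b') (esL _) (⊳-⟶m*-esForm ra) ++m map-⟶m* (es (esForm _)) (esR _) (⊳-⟶m*-esForm rb)

-- Every redex of esForm u comes from a shuffling redex of u: an e-redex
-- t[x←L⟨v⟩] from (λx.t)v (βv) or (λx.t)((λy.s)u) (σ₃), and an m-redex from σ₁.
esForm-⟶-normal : ∀ {n} (u : Tm n) → shuf-normal u → ∀ {r} b → ¬ (esForm u ⟶[ r ] b)
esForm-⟶-normal (var x) h b ()
esForm-⟶-normal (lam t) h b ()
esForm-⟶-normal (app (lam t) c) h b (esL _ s) = esForm-⟶-normal t (λ { u' (_ , s') → h _ (_ , lamApp c s') }) _ s
esForm-⟶-normal (app (lam t) c) h b (esR _ s) = esForm-⟶-normal c (λ { u' (_ , s') → h _ (_ , appR _ s') }) _ s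
esForm-⟶-normal (app (lam t) (var x)) h b (e-root _ _) = h _ (_ , root-βv t (var x) (var-val x))
esForm-⟶-normal (app (lam t) (lam c)) h b (e-root _ _) = h _ (_ , root-βv t (lam c) (lam-val c))
esForm-⟶-normal (app (lam t) (app (lam c₁) c₂)) h b (e-root _ _) = h _ (_ , root-σ₃ (lam t) (lam-val t) c₁ c₂)
esForm-⟶-normal (app (lam t) (app (var x) c)) h b (e-root _ (val ()))
esForm-⟶-normal (app (lam t) (app (app c₁ c₂) c₃)) h b (e-root _ (val ()))
esForm-⟶-normal (app (var x) c) h b (appR _ s) = esForm-⟶-normal c (λ { u' (_ , s') → h _ (_ , appR _ s') }) _ s
esForm-⟶-normal (app (app a c) d) h b (appL _ s) =
  esForm-⟶-normal (app a c) (λ { u' (_ , s') → h _ (_ , appL _ s') }) _ s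
esForm-⟶-normal (app (app a c) d) h b (appR _ s) = esForm-⟶-normal d (λ { u' (_ , s') → h _ (_ , appR _ s') }) _ s
esForm-⟶-normal (app (app (lam a) c) d) h b (m-root _ _) = h _ (_ , root-σ₁ a c d)

esForm-vsub-normal : ∀ {n} {u : Tm n} → shuf-normal u → vsub-normal (esForm u)
esForm-vsub-normal {u = u} h b (_ , s) = esForm-⟶-normal u h b (⟶vsub⇒⟶ s)

vsub-normal-≡str : ∀ {n} {a b : VTm n} → a ≡str b → vsub-normal b → vsub-normal a
vsub-normal-≡str eq nb c (_ , s) with proj₁ (≡str-bisim eq) .step (⟶vsub⇒⟶ s)
... | c' , s' , _ = nb c' (_ , ⟶⇒⟶vsub s')

vsub-normal-⟶m* : ∀ {n} {a b : VTm n} → vsub-normal a → a ⟶m* b → a ≡ b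
vsub-normal-⟶m* na []      = refl
vsub-normal-⟶m* na (s ∷ _) = ⊥-elim (na _ (_ , s))

theorem2 : ∀ {n} (t u : Tm n) (d : ShufDeriv t u) →
    Σ (VTm n) λ s → Σ (VsubDeriv ⌜ t ⌝ s) λ e → Σ (VTm n) λ mnfu →
      IsMnf ⌜ u ⌝ mnfu
      × (s ≡str mnfu)
      × (βv-count d ≡ e-count e)
      × (shuf-normal u → vsub-normal s × vsub-normal mnfu)
theorem2 t u d with ⊳-simulation d (⊳-refl t)
... | reaches e₁ rel eq count₁ with m-normalise (esForm u)
... | v , m , v-m-normal with ≡str-postpone eq (⟶m*⇒VsubDeriv (⊳-⟶m*-esForm rel ++m m))
... | s , e₂ , s≡v , count₂ =
  s , e₁ ++ e₂ , v , (⊳-⟶m*-esForm (⊳-refl u) ++m m , v-m-normal) , s≡v , counts , normal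
  where
    e₂-count : e-count e₂ ≡ 0
    e₂-count = trans count₂ (e-count-⟶m* (⊳-⟶m*-esForm rel ++m m))
    counts : βv-count d ≡ e-count (e₁ ++ e₂)
    counts = begin
      βv-count d               ≡⟨ sym count₁ ⟩
      e-count e₁               ≡⟨ sym (+-identityʳ _) ⟩
      e-count e₁ + 0           ≡⟨ cong (e-count e₁ +_) (sym e₂-count) ⟩
      e-count e₁ + e-count e₂  ≡⟨ sym (e-count-++ e₁ e₂) ⟩
      e-count (e₁ ++ e₂)       ∎
      where open ≡-Reasoning
    normal : shuf-normal u → vsub-normal s × vsub-normal v
    normal h = vsub-normal-≡str s≡v v-normal , v-normal
      where
        v-normal : vsub-normal v
        v-normal = subst vsub-normal (vsub-normal-⟶m* (esForm-vsub-normal h) m) (esForm-vsub-normal h)
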